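{- A cubic graph $\Gamma$ admits a partial orientation as a quasi-transitive mixed graph if and only if $\Gamma$ contains no copy of $\Pi$ (as a subgraph) and the subgraph of $\Gamma$ formed by the set of edges of $\Gamma$ that are not contained in any copy of $K_3$ contains no odd cycle.
   Context: $\Pi$ is the graph on six vertices consisting of a triangle with a pendant edge attached at each of its three vertices. The graph formed from a set $X$ of edges has as vertices the endpoints of edges in $X$ and edge set $X$. A mixed graph has a vertex set, a set of (undirected) edges and a set of arcs, with at most one edge or arc between any pair of vertices. A partial orientation of a graph is a mixed graph obtained by orienting some of its edges as arcs. A $2$-dipath is a directed path $xyz$ consisting of arcs $x\to y$, $y\to z$; it is induced if $x$ and $z$ are not joined by an edge or arc. A mixed graph $H$ is quasi-transitive when (1) it has no induced $2$-dipath and (2) for every edge $xy$ there is $t$ with $xty$ or $ytx$ a $2$-dipath. -}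

module Defs where

open import Data.Nat using (ℕ; zero; suc; _+_; _≤_)
open import Data.Fin using (Fin; zero; suc; inject₁; fromℕ)
open import Data.List using (length; filterᵇ; allFin)
open import Data.Bool using (Bool; true; false)
open import Data.Product using (Σ; ∃; _×_; _,_)
open import Data.Sum using (_⊎_)
open import Relation.Nullary using (¬_)
open import Relation.Binary.PropositionalEquality using (_≡_; _≢_)
open import Function.Definitions using (Injective)

record Graph (n : ℕ) : Set where
  field
    adj   : Fin n → Fin n → Bool
    sym   : ∀ x y → adj x y ≡ adj y x
    irrefl : ∀ x → adj x x ≡ false

open Graph public

Adj : ∀ {n} → Graph n → Fin n → Fin n → Set
Adj Γ x y = adj Γ x y ≡ true

degree : ∀ {n} → Graph n → Fin n → ℕ
degree {n} Γ v = length (filterᵇ (adj Γ v) (allFin n))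

Cubic : ∀ {n} → Graph n → Set
Cubic {n} Γ = ∀ (v : Fin n) → degree Γ v ≡ 3

-- The edges of Γ not oriented remain (undirected) edges of the mixed graph.
record PartialOrientation {n} (Γ : Graph n) : Set where
  field
    arc      : Fin n → Fin n → Bool
    arc⇒adj  : ∀ x y → arc x y ≡ true → Adj Γ x y
    antisym  : ∀ x y → arc x y ≡ true → arc y x ≡ false

open PartialOrientation public

module _ {n} {Γ : Graph n} (H : PartialOrientation Γ) where

  Arc : Fin n → Fin n → Set
  Arc x y = arc H x y ≡ true

  Edge : Fin n → Fin n → Set
  Edge x y = Adj Γ x y × ¬ Arc x y × ¬ Arc y x

  TwoDipath : Fin n → Fin n → Fin n → Set
  TwoDipath x y z = Arc x y × Arc y z

  -- induced: x and z not joined by an edge or an arc (i.e. not adjacent in Γ)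
  InducedTwoDipath : Fin n → Fin n → Fin n → Set
  InducedTwoDipath x y z = TwoDipath x y z × ¬ Adj Γ x z

  QuasiTransitive : Set
  QuasiTransitive =
    (∀ x y z → ¬ InducedTwoDipath x y z) ×
    (∀ x y → Edge x y → ∃ λ t → TwoDipath x t y ⊎ TwoDipath y t x)

data ΠEdge : Fin 6 → Fin 6 → Set where
  e01 : ΠEdge zero (suc zero)
  e12 : ΠEdge (suc zero) (suc (suc zero))
  e20 : ΠEdge (suc (suc zero)) zero
  e03 : ΠEdge zero (suc (suc (suc zero)))
  e14 : ΠEdge (suc zero) (suc (suc (suc (suc zero))))
  e25 : ΠEdge (suc (suc zero)) (suc (suc (suc (suc (suc zero)))))

ContainsΠ : ∀ {n} → Graph n → Set
ContainsΠ {n} Γ = Σ (Fin 6 → Fin n) λ f →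
  Injective _≡_ _≡_ f × (∀ i j → ΠEdge i j → Adj Γ (f i) (f j))

InTriangle : ∀ {n} → Graph n → Fin n → Fin n → Set
InTriangle Γ x y = ∃ λ z → Adj Γ x z × Adj Γ y z

NonTriAdj : ∀ {n} → Graph n → Fin n → Fin n → Set
NonTriAdj Γ x y = Adj Γ x y × ¬ InTriangle Γ x y

Odd : ℕ → Set
Odd k = ∃ λ j → k ≡ suc (j + j)

-- a cycle of length (suc m) ≥ 3 w.r.t. a relation R on Fin n:
-- distinct vertices c 0, …, c m with c i R c (i+1) and c m R c 0
record Cycle {n} (R : Fin n → Fin n → Set) (m : ℕ) : Set where
  field
    vtx     : Fin (suc m) → Fin n
    long    : 2 ≤ m
    distinct : Injective _≡_ _≡_ vtx
    step    : ∀ (i : Fin m) → R (vtx (inject₁ i)) (vtx (suc i))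
    close   : R (vtx (fromℕ m)) (vtx zero)

HasOddCycle : ∀ {n} → (Fin n → Fin n → Set) → Set
HasOddCycle R = ∃ λ m → Odd (suc m) × Cycle R m

-- An edge in no triangle has no common neighbour to witness it, so a quasi-transitive
-- orientation orients it; two such arcs cannot meet head to tail (the chord would create a triangle),
-- so "has an outgoing non-triangle arc" is a proper 2-colouring of those edges. In a copy of Π each
-- pendant edge is oriented and makes its triangle vertex a source or a sink; each triangle edge is
-- then oriented as well, which no three vertices that are all sources or sinks allow. Without odd cycles the non-triangle edges are 2-coloured and oriented by colour.
-- Without Π every triangle lies in a K₄ or a diamond, and these are oriented by a fixed vertex order,
-- adjusted at the tips of the diamonds to agree with the colouring (see Arrow).
module Submission where

open import Defs hiding (sym)
open import Data.Bool using (Bool; true; false; not; _xor_; if_then_else_; T?)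
open import Data.Bool.Properties using (xor-same; xor-identityʳ; not-distribˡ-xor; not-distribʳ-xor; not-involutive; not-injective; xor-assoc; ¬-not; not-¬; T-≡)
  renaming (_≟_ to _≟ᵇ_)
open import Data.Bool.Solver using (module xor-∧-Solver)
open xor-∧-Solver using (solve; _:=_; _:+_; con)
open import Data.Empty using (⊥-elim)
open import Data.Fin using (Fin; zero; suc; inject₁; fromℕ; toℕ; _<_; _≟_)
open import Data.Fin.Induction using (<-weakInduction)
open import Data.Fin.Patterns using (0F; 1F; 2F; 3F; 4F; 5F)
open import Data.Fin.Properties using (toℕ-inject₁; toℕ-fromℕ; any?; _<?_; <-cmp; <-asym)
open import Data.List using (List; []; _∷_; _++_; length; lookup; filterᵇ; allFin; cartesianProduct)
open import Data.List.Properties using (length-++)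
open import Data.List.Membership.Propositional using (_∈_)
open import Data.List.Membership.Propositional.Properties
  using (∈-filter⁺; ∈-filter⁻; ∈-allFin; ∈-∃++; ∈-++⁻; ∈-++⁺ˡ; ∈-++⁺ʳ; ∈-lookup; ∈-cartesianProduct⁺)
import Data.List.Membership.DecPropositional as DecMembership
open import Data.List.Relation.Unary.Any using (here; there)
open import Data.List.Relation.Unary.All using ([]; _∷_)
import Data.List.Relation.Unary.All as All
open import Data.List.Relation.Unary.All.Properties using (¬Any⇒All¬)
open import Data.List.Relation.Unary.AllPairs using ([]; _∷_)
open import Data.List.Relation.Unary.Unique.Propositional using (Unique)
open import Data.List.Relation.Unary.Unique.Propositional.Properties using (filter⁺; allFin⁺)
open import Data.Nat using (ℕ; zero; suc; _+_; _≤_; z≤n; s≤s)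
open import Data.Nat.Properties using (<-irrefl; ≤-refl; +-suc; ≤-trans; ≤-pred; m≤m+n; m≤n+m)
open import Data.Product using (Σ; ∃; _×_; _,_; proj₁; proj₂)
open import Data.Sum using (_⊎_; inj₁; inj₂; [_,_]′; swap)
open import Function using (_∘_; case_of_)
open import Function.Bundles using (_⇔_; mk⇔; Equivalence)
open import Function.Definitions using (Injective)
open import Relation.Binary.Definitions using (DecidableEquality; Decidable; Symmetric; tri<; tri≈; tri>)
open import Relation.Binary.PropositionalEquality using (_≡_; _≢_; ≢-sym; refl; sym; trans; cong; cong₂; subst; module ≡-Reasoning)
open import Relation.Nullary using (¬_; Dec; yes; no; does)
open import Relation.Nullary.Decidable using (¬?; _×-dec_; dec-true; dec-false)

length-++-∷ : ∀ {A : Set} (xs : List A) y ys → length (xs ++ y ∷ ys) ≡ suc (length (xs ++ ys))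
length-++-∷ []       y ys = refl
length-++-∷ (x ∷ xs) y ys = cong suc (length-++-∷ xs y ys)

Unique-⊆⇒length≤ : ∀ {A : Set} (xs ys : List A) → Unique xs → (∀ {z} → z ∈ xs → z ∈ ys) →
                   length xs ≤ length ys
Unique-⊆⇒length≤ []       ys _           _     = z≤n
Unique-⊆⇒length≤ (x ∷ xs) ys (x∉xs ∷ xs!) xs⊆ys with ∈-∃++ (xs⊆ys (here refl))
... | ys₁ , ys₂ , refl =
  subst (suc (length xs) ≤_) (sym (length-++-∷ ys₁ x ys₂))
        (s≤s (Unique-⊆⇒length≤ xs (ys₁ ++ ys₂) xs! xs⊆ys₁++ys₂))
  where
  xs⊆ys₁++ys₂ : ∀ {z} → z ∈ xs → z ∈ ys₁ ++ ys₂
  xs⊆ys₁++ys₂ z∈xs with ∈-++⁻ ys₁ (xs⊆ys (there z∈xs))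
  ... | inj₁ z∈ys₁          = ∈-++⁺ˡ z∈ys₁
  ... | inj₂ (here refl)    = ⊥-elim (All.lookup x∉xs z∈xs refl)
  ... | inj₂ (there z∈ys₂) = ∈-++⁺ʳ ys₁ z∈ys₂

Unique⇒lookup-injective : ∀ {A : Set} (xs : List A) → Unique xs → Injective _≡_ _≡_ (lookup xs)
Unique⇒lookup-injective (x ∷ xs) _           {zero}  {zero}  _ = refl
Unique⇒lookup-injective (x ∷ xs) (x∉xs ∷ _) {zero}  {suc j} x≡xsⱼ =
  ⊥-elim (All.lookup x∉xs (∈-lookup {xs = xs} j) x≡xsⱼ)
Unique⇒lookup-injective (x ∷ xs) (x∉xs ∷ _) {suc i} {zero}  xsᵢ≡x =
  ⊥-elim (All.lookup x∉xs (∈-lookup {xs = xs} i) (sym xsᵢ≡x))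
Unique⇒lookup-injective (x ∷ xs) (_ ∷ xs!)  {suc i} {suc j} xsᵢ≡xsⱼ =
  cong suc (Unique⇒lookup-injective xs xs! xsᵢ≡xsⱼ)

HasDuplicate : ∀ {A : Set} → List A → Set
HasDuplicate xs = ∃ λ as → ∃ λ v → ∃ λ bs → ∃ λ cs → xs ≡ as ++ v ∷ bs ++ v ∷ cs

duplicate-or-Unique : ∀ {A : Set} → DecidableEquality A → (xs : List A) → HasDuplicate xs ⊎ Unique xs
duplicate-or-Unique _≟ₐ_ []       = inj₂ []
duplicate-or-Unique _≟ₐ_ (x ∷ xs) with DecMembership._∈?_ _≟ₐ_ x xs | duplicate-or-Unique _≟ₐ_ xs
... | yes x∈xs | _ with ∈-∃++ x∈xs
...   | bs , cs , refl = inj₁ ([] , x , bs , cs , refl)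
duplicate-or-Unique _≟ₐ_ (x ∷ xs) | no x∉xs | inj₁ (as , v , bs , cs , refl) = inj₁ (x ∷ as , v , bs , cs , refl)
duplicate-or-Unique _≟ₐ_ (x ∷ xs) | no x∉xs | inj₂ xs!                         = inj₂ (¬Any⇒All¬ xs x∉xs ∷ xs!)

parity : ℕ → Bool
parity zero    = false
parity (suc k) = not (parity k)

parity-+ : ∀ a b → parity (a + b) ≡ parity a xor parity b
parity-+ zero    b = refl
parity-+ (suc a) b = trans (cong not (parity-+ a b)) (not-distribˡ-xor (parity a) (parity b))

parity-double : ∀ j → parity (j + j) ≡ false
parity-double j = trans (parity-+ j j) (xor-same (parity j))

Odd⇒parity : ∀ k → Odd k → parity k ≡ true
Odd⇒parity _ (j , refl) = cong not (parity-double j)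

parity⇒Odd : ∀ k → parity k ≡ true → Odd k
parity⇒Odd zero          ()
parity⇒Odd (suc zero)    _ = 0 , refl
parity⇒Odd (suc (suc k)) p with parity⇒Odd k (trans (sym (not-involutive (parity k))) p)
... | j , refl = suc j , cong (2 +_) (sym (+-suc j j))

xor≡true : ∀ a b → a xor b ≡ true → a ≡ true ⊎ b ≡ true
xor≡true true  _ _ = inj₁ refl
xor≡true false _ p = inj₂ p

module Walks {n} (R : Fin n → Fin n → Set) where

  -- Walk x y vs: a walk from x to y whose vertices before y are vs, so length vs is its length
  data Walk : Fin n → Fin n → List (Fin n) → Set where
    ε   : ∀ {x} → Walk x x []
    _◅_ : ∀ {x y z vs} → R x y → Walk y z vs → Walk x z (x ∷ vs)

  infixr 5 _◅_ _◅◅_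

  _◅◅_ : ∀ {x y z vs ws} → Walk x y vs → Walk y z ws → Walk x z (vs ++ ws)
  ε       ◅◅ q = q
  (r ◅ p) ◅◅ q = r ◅ (p ◅◅ q)

  split-at : ∀ vs {v ws x z} → Walk x z (vs ++ v ∷ ws) → Walk x v vs × Walk v z (v ∷ ws)
  split-at []       (r ◅ p) = ε , r ◅ p
  split-at (_ ∷ vs) (r ◅ p) = let p₁ , p₂ = split-at vs p in r ◅ p₁ , p₂

  walk-steps : ∀ {x z} vs → Walk x z (x ∷ vs) →
    (∀ i → R (lookup (x ∷ vs) (inject₁ i)) (lookup (x ∷ vs) (suc i))) ×
    R (lookup (x ∷ vs) (fromℕ (length vs))) z
  walk-steps []       (r ◅ ε)         = (λ ()) , r
  walk-steps (_ ∷ vs) (r ◅ p@(_ ◅ _)) =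
    let steps , last = walk-steps vs p in (λ { zero → r ; (suc i) → steps i }) , last

  length-split : ∀ (as : List (Fin n)) v bs cs →
    length (as ++ v ∷ bs ++ v ∷ cs) ≡ length (v ∷ bs) + length (as ++ v ∷ cs)
  length-split []       v bs cs = cong suc (length-++ bs)
  length-split (a ∷ as) v bs cs =
    trans (cong suc (length-split as v bs cs)) (sym (+-suc (length (v ∷ bs)) (length (as ++ v ∷ cs))))

  split-lengths≤ : ∀ (as : List (Fin n)) v bs cs {k} → length (as ++ v ∷ bs ++ v ∷ cs) ≤ suc k →
                   length (v ∷ bs) ≤ k × length (as ++ v ∷ cs) ≤ k
  split-lengths≤ as v bs cs ≤k rewrite length-split as v bs cs | length-++-∷ as v cs = summands≤ ≤k
    where
    summands≤ : ∀ {a b k} → suc a + suc b ≤ suc k → suc a ≤ k × suc b ≤ k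
    summands≤ {a} {b} {k} ≤sk = let a+b< = subst (_≤ k) (+-suc a b) (≤-pred ≤sk) in
      ≤-trans (s≤s (m≤m+n a b)) a+b< , ≤-trans (s≤s (m≤n+m b a)) a+b<

  module _ (R-irrefl : ∀ {x} → ¬ R x x) where

    Unique-odd-closed-walk⇒odd-cycle : ∀ {x} vs → Unique vs → Walk x x vs → parity (length vs) ≡ true →
                                       HasOddCycle R
    Unique-odd-closed-walk⇒odd-cycle []                   _  _           ()
    Unique-odd-closed-walk⇒odd-cycle (_ ∷ [])             _  (r ◅ ε)     _ = ⊥-elim (R-irrefl r)
    Unique-odd-closed-walk⇒odd-cycle (_ ∷ _ ∷ [])         _  _           ()
    Unique-odd-closed-walk⇒odd-cycle (y ∷ vs@(_ ∷ _ ∷ _)) vs! w@(_ ◅ _) odd =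
      length vs , parity⇒Odd _ odd , record
        { vtx      = lookup (y ∷ vs)
        ; long     = s≤s (s≤s z≤n)
        ; distinct = Unique⇒lookup-injective (y ∷ vs) vs!
        ; step     = proj₁ (walk-steps vs w)
        ; close    = proj₂ (walk-steps vs w)
        }

    -- A repeated vertex splits a closed walk into two shorter closed walks, one of them odd.
    odd-closed-walk⇒odd-cycle : ∀ k {x vs} → length vs ≤ k → Walk x x vs → parity (length vs) ≡ true →
                                HasOddCycle R
    odd-closed-walk⇒odd-cycle k {vs = vs} ≤k w odd with duplicate-or-Unique _≟_ vs
    ... | inj₂ vs! = Unique-odd-closed-walk⇒odd-cycle vs vs! w odd
    odd-closed-walk⇒odd-cycle zero    ≤k w odd | inj₁ (as , v , bs , cs , refl)
      with () ← subst (_≤ 0) (length-split as v bs cs) ≤k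
    odd-closed-walk⇒odd-cycle (suc k) ≤k w odd | inj₁ (as , v , bs , cs , refl) =
      let x→v , v→x     = split-at as w
          loop , v→x′   = split-at (v ∷ bs) v→x
          loop≤ , rest≤ = split-lengths≤ as v bs cs ≤k
      in [ odd-closed-walk⇒odd-cycle k loop≤ loop
         , odd-closed-walk⇒odd-cycle k rest≤ (x→v ◅◅ v→x′)
         ]′ (xor≡true _ _ (trans (sym (parity-+ (length (v ∷ bs)) (length (as ++ v ∷ cs))))
                                 (subst (λ l → parity l ≡ true) (length-split as v bs cs) odd)))

ProperColouring : ∀ {n} → (Fin n → Fin n → Set) → (Fin n → Bool) → Set
ProperColouring R c = ∀ {x y} → R x y → c x ≢ c y

ProperColouring⇒¬HasOddCycle : ∀ {n} {R : Fin n → Fin n → Set} {c} → ProperColouring R c → ¬ HasOddCycle R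
ProperColouring⇒¬HasOddCycle {c = c} proper (m , odd , cycle) =
  proper close (trans (colour-along (fromℕ m)) closing-colour)
  where
  open Cycle cycle
  open ≡-Reasoning

  colour-along : ∀ i → c (vtx i) ≡ c (vtx zero) xor parity (toℕ i)
  colour-along = <-weakInduction _ (sym (xor-identityʳ _)) λ i ih → begin
    c (vtx (suc i))                                         ≡⟨ ¬-not (≢-sym (proper (step i))) ⟩
    not (c (vtx (inject₁ i)))                               ≡⟨ cong not ih ⟩
    not (c (vtx zero) xor parity (toℕ (inject₁ i)))         ≡⟨ not-distribʳ-xor (c (vtx zero)) _ ⟩
    c (vtx zero) xor not (parity (toℕ (inject₁ i)))         ≡⟨ cong (λ k → c (vtx zero) xor not (parity k)) (toℕ-inject₁ i) ⟩
    c (vtx zero) xor not (parity (toℕ i))                   ∎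

  closing-colour : c (vtx zero) xor parity (toℕ (fromℕ m)) ≡ c (vtx zero)
  closing-colour = begin
    c (vtx zero) xor parity (toℕ (fromℕ m)) ≡⟨ cong (λ k → c (vtx zero) xor parity k) (toℕ-fromℕ m) ⟩
    c (vtx zero) xor parity m               ≡⟨ cong (c (vtx zero) xor_) (not-injective (Odd⇒parity _ odd)) ⟩
    c (vtx zero) xor false                  ≡⟨ xor-identityʳ _ ⟩
    c (vtx zero)                            ∎

xor-cancelʳ : ∀ a f → (a xor f) xor f ≡ a
xor-cancelʳ a f = trans (xor-assoc a f f) (trans (cong (a xor_) (xor-same f)) (xor-identityʳ a))

xor-injectiveˡ : ∀ {a b} f → a xor f ≡ b xor f → a ≡ b
xor-injectiveˡ {a} {b} f e = trans (sym (xor-cancelʳ a f)) (trans (cong (_xor f) e) (xor-cancelʳ b f))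

module TwoColouring {n} (R : Fin n → Fin n → Set) (R? : Decidable R) (R-sym : Symmetric R)
                    (R-irrefl : ∀ {x} → ¬ R x x) (no-odd-cycle : ¬ HasOddCycle R) where
  open Walks R
  open ≡-Reasoning

  ParityWalk : Fin n → Fin n → Bool → Set
  ParityWalk x y b = ∃ λ vs → Walk x y vs × parity (length vs) ≡ b

  reparity : ∀ {x y b b′} → ParityWalk x y b → b ≡ b′ → ParityWalk x y b′
  reparity (vs , w , p) b≡b′ = vs , w , trans p b≡b′

  join : ∀ {x a b y s t} → ParityWalk x a s → R a b → ParityWalk b y t → ParityWalk x y (s xor not t)
  join {a = a} {s = s} {t} (vs , p , vs-parity) ab (ws , q , ws-parity) = vs ++ a ∷ ws , p ◅◅ ab ◅ q , (begin
    parity (length (vs ++ a ∷ ws))                   ≡⟨ cong parity (length-++ vs) ⟩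
    parity (length vs + suc (length ws))             ≡⟨ parity-+ (length vs) (suc (length ws)) ⟩
    parity (length vs) xor not (parity (length ws))  ≡⟨ cong₂ (λ s t → s xor not t) vs-parity ws-parity ⟩
    s xor not t                                      ∎)

  ¬even-walk-along-edge : ∀ {u v} → R u v → ¬ ParityWalk u v false
  ¬even-walk-along-edge {v = v} uv (vs , w , even) =
    no-odd-cycle (odd-closed-walk⇒odd-cycle R-irrefl _ ≤-refl (w ◅◅ R-sym uv ◅ ε) (begin
      parity (length (vs ++ v ∷ []))  ≡⟨ cong parity (length-++ vs) ⟩
      parity (length vs + 1)          ≡⟨ parity-+ (length vs) 1 ⟩
      parity (length vs) xor true     ≡⟨ cong (_xor true) even ⟩
      true                            ∎))

  Linked : (Fin n → Bool) → Fin n → Fin n → Set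
  Linked c x y = ParityWalk x y (c x xor c y)

  -- comp labels the components grown so far; linked makes the colouring forced on each of them.
  record PartialColouring (P : List (Fin n × Fin n)) : Set where
    field
      comp      : Fin n → Fin n
      colour    : Fin n → Bool
      proper-on : ∀ {a b} → (a , b) ∈ P → R a b → comp a ≡ comp b × colour a ≢ colour b
      linked    : ∀ {x y} → comp x ≡ comp y → Linked colour x y

  open PartialColouring

  initial : PartialColouring []
  initial = record
    { comp      = λ x → x
    ; colour    = λ _ → false
    ; proper-on = λ ()
    ; linked    = λ { refl → [] , ε , refl }
    }

  merge : ∀ {P u v} (C : PartialColouring P) → R u v → comp C u ≢ comp C v → PartialColouring ((u , v) ∷ P)
  merge {P} {u} {v} C uv different = record
    { comp = comp′ ; colour = colour′ ; proper-on = proper-on′ ; linked = linked′ }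
    where
    flip : Bool
    flip = not (colour C u xor colour C v)

    comp′ : Fin n → Fin n
    comp′ x = if does (comp C x ≟ comp C v) then comp C u else comp C x

    colour′ : Fin n → Bool
    colour′ x = if does (comp C x ≟ comp C v) then colour C x xor flip else colour C x

    v-recoloured : colour C v xor flip ≡ not (colour C u)
    v-recoloured = solve 2 (λ u v → v :+ (con true :+ (u :+ v)) := con true :+ u) refl (colour C u) (colour C v)

    proper-on′ : ∀ {a b} → (a , b) ∈ (u , v) ∷ P → R a b → comp′ a ≡ comp′ b × colour′ a ≢ colour′ b
    proper-on′ (here refl) _ with comp C u ≟ comp C v | comp C v ≟ comp C v
    ... | yes u∼v | _       = ⊥-elim (different u∼v)
    ... | no _    | no v≁v  = ⊥-elim (v≁v refl)
    ... | no _    | yes _   = refl , λ cu≡cv′ → not-¬ refl (trans cu≡cv′ v-recoloured)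
    proper-on′ {a} {b} (there ab∈P) ab with proper-on C ab∈P ab
    ... | a∼b , ca≢cb with comp C a ≟ comp C v | comp C b ≟ comp C v
    ...   | yes _   | yes _   = refl , ca≢cb ∘ xor-injectiveˡ flip
    ...   | no _    | no _    = a∼b , ca≢cb
    ...   | yes a∼v | no b≁v  = ⊥-elim (b≁v (trans (sym a∼b) a∼v))
    ...   | no a≁v  | yes b∼v = ⊥-elim (a≁v (trans a∼b b∼v))

    linked′ : ∀ {x y} → comp′ x ≡ comp′ y → Linked colour′ x y
    linked′ {x} {y} x∼y with comp C x ≟ comp C v | comp C y ≟ comp C v
    ... | yes x∼v | yes y∼v = reparity (linked C (trans x∼v (sym y∼v)))
      (solve 3 (λ x y f → x :+ y := (x :+ f) :+ (y :+ f)) refl (colour C x) (colour C y) flip)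
    ... | no _    | no _    = linked C x∼y
    ... | yes x∼v | no _    = reparity (join (linked C x∼v) (R-sym uv) (linked C x∼y))
      (solve 4 (λ x y u v → (x :+ v) :+ (con true :+ (u :+ y)) := (x :+ (con true :+ (u :+ v))) :+ y) refl
             (colour C x) (colour C y) (colour C u) (colour C v))
    ... | no _    | yes y∼v = reparity (join (linked C x∼y) uv (linked C (sym y∼v)))
      (solve 4 (λ x y u v → (x :+ u) :+ (con true :+ (v :+ y)) := x :+ (y :+ (con true :+ (u :+ v)))) refl
             (colour C x) (colour C y) (colour C u) (colour C v))

  keep-colouring : ∀ {P u v} (C : PartialColouring P) →
                   (R u v → comp C u ≡ comp C v × colour C u ≢ colour C v) → PartialColouring ((u , v) ∷ P)
  keep-colouring C uv-proper = record
    { comp      = comp C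
    ; colour    = colour C
    ; proper-on = λ { (here refl) → uv-proper ; (there ab∈P) → proper-on C ab∈P }
    ; linked    = linked C
    }

  add-pair : ∀ {P} u v → PartialColouring P → PartialColouring ((u , v) ∷ P)
  add-pair u v C with R? u v | comp C u ≟ comp C v
  ... | no ¬uv | _       = keep-colouring C (⊥-elim ∘ ¬uv)
  ... | yes uv | yes u∼v = keep-colouring C λ _ → u∼v , λ cu≡cv →
    ¬even-walk-along-edge uv (reparity (linked C u∼v) (trans (cong (_xor colour C v) cu≡cv) (xor-same (colour C v))))
  ... | yes uv | no u≁v  = merge C uv u≁v

  colour-pairs : ∀ P → PartialColouring P
  colour-pairs []            = initial
  colour-pairs ((u , v) ∷ P) = add-pair u v (colour-pairs P)

  proper-colouring : ∃ (ProperColouring R)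
  proper-colouring = colour C , λ {x} {y} xy → proj₂ (proper-on C (∈-cartesianProduct⁺ (∈-allFin x) (∈-allFin y)) xy)
    where
    C : PartialColouring (cartesianProduct (allFin n) (allFin n))
    C = colour-pairs _

true≢false : true ≢ false
true≢false ()

module GraphFacts {n} (Γ : Graph n) where

  adj? : ∀ x y → Dec (Adj Γ x y)
  adj? x y = adj Γ x y ≟ᵇ true

  adj-sym : ∀ {x y} → Adj Γ x y → Adj Γ y x
  adj-sym {x} {y} xy = trans (Graph.sym Γ y x) xy

  adj-irrefl : ∀ {x} → ¬ Adj Γ x x
  adj-irrefl {x} xx = true≢false (trans (sym xx) (irrefl Γ x))

  adj⇒≢ : ∀ {x y} → Adj Γ x y → x ≢ y
  adj⇒≢ xy refl = adj-irrefl xy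

  InTriangle? : ∀ x y → Dec (InTriangle Γ x y)
  InTriangle? x y = any? λ z → adj? x z ×-dec adj? y z

  InTriangle-sym : ∀ {x y} → InTriangle Γ x y → InTriangle Γ y x
  InTriangle-sym (z , xz , yz) = z , yz , xz

  NonTriAdj? : ∀ x y → Dec (NonTriAdj Γ x y)
  NonTriAdj? x y = adj? x y ×-dec ¬? (InTriangle? x y)

  NonTriAdj-sym : Symmetric (NonTriAdj Γ)
  NonTriAdj-sym (xy , ¬tri) = adj-sym xy , ¬tri ∘ InTriangle-sym

  NonTriAdj-irrefl : ∀ {x} → ¬ NonTriAdj Γ x x
  NonTriAdj-irrefl (xx , _) = adj-irrefl xx

  ¬NonTriAdj⇒InTriangle : ∀ {x y} → Adj Γ x y → ¬ NonTriAdj Γ x y → InTriangle Γ x y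
  ¬NonTriAdj⇒InTriangle {x} {y} xy ¬nt with InTriangle? x y
  ... | yes tri = tri
  ... | no ¬tri = ⊥-elim (¬nt (xy , ¬tri))

module CubicFacts {n} (Γ : Graph n) (cubic : Cubic Γ) where
  open GraphFacts Γ

  neighbours : Fin n → List (Fin n)
  neighbours v = filterᵇ (adj Γ v) (allFin n)

  ∈-neighbours⁺ : ∀ {v w} → Adj Γ v w → w ∈ neighbours v
  ∈-neighbours⁺ {v} {w} vw = ∈-filter⁺ (T? ∘ adj Γ v) (∈-allFin w) (Equivalence.from T-≡ vw)

  ∈-neighbours⁻ : ∀ {v w} → w ∈ neighbours v → Adj Γ v w
  ∈-neighbours⁻ {v} w∈ = Equivalence.to T-≡ (proj₂ (∈-filter⁻ (T? ∘ adj Γ v) {xs = allFin n} w∈))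

  neighbour-is-one-of : ∀ {v a b c w} → Adj Γ v a → Adj Γ v b → Adj Γ v c → a ≢ b → a ≢ c → b ≢ c →
                        Adj Γ v w → w ≡ a ⊎ w ≡ b ⊎ w ≡ c
  neighbour-is-one-of {v} {a} {b} {c} {w} va vb vc a≢b a≢c b≢c vw with w ≟ a | w ≟ b | w ≟ c
  ... | yes w≡a | _       | _       = inj₁ w≡a
  ... | no _    | yes w≡b | _       = inj₂ (inj₁ w≡b)
  ... | no _    | no _    | yes w≡c = inj₂ (inj₂ w≡c)
  ... | no w≢a  | no w≢b  | no w≢c  =
    ⊥-elim (<-irrefl refl (subst (4 ≤_) (cubic v)
      (Unique-⊆⇒length≤ (a ∷ b ∷ c ∷ w ∷ []) (neighbours v) distinct ⊆neighbours)))
    where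
    distinct : Unique (a ∷ b ∷ c ∷ w ∷ [])
    distinct = (a≢b ∷ a≢c ∷ ≢-sym w≢a ∷ []) ∷ (b≢c ∷ ≢-sym w≢b ∷ []) ∷ (≢-sym w≢c ∷ []) ∷ [] ∷ []
    ⊆neighbours : ∀ {z} → z ∈ a ∷ b ∷ c ∷ w ∷ [] → z ∈ neighbours v
    ⊆neighbours (here refl)                         = ∈-neighbours⁺ va
    ⊆neighbours (there (here refl))                 = ∈-neighbours⁺ vb
    ⊆neighbours (there (there (here refl)))         = ∈-neighbours⁺ vc
    ⊆neighbours (there (there (there (here refl)))) = ∈-neighbours⁺ vw

  third-neighbour : ∀ {v a b} → Adj Γ v a → Adj Γ v b → ∃ λ c → Adj Γ v c × c ≢ a × c ≢ b
  third-neighbour {v} {a} {b} _ _ with any? (λ c → adj? v c ×-dec ¬? (c ≟ a) ×-dec ¬? (c ≟ b))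
  ... | yes found = found
  ... | no none   =
    ⊥-elim (<-irrefl refl (subst (_≤ 2) (cubic v)
      (Unique-⊆⇒length≤ (neighbours v) (a ∷ b ∷ []) (filter⁺ (T? ∘ adj Γ v) (allFin⁺ n)) ⊆ab)))
    where
    ⊆ab : ∀ {z} → z ∈ neighbours v → z ∈ a ∷ b ∷ []
    ⊆ab {z} z∈ with z ≟ a | z ≟ b
    ... | yes refl | _        = here refl
    ... | no _     | yes refl = there (here refl)
    ... | no z≢a   | no z≢b   = ⊥-elim (none (z , ∈-neighbours⁻ z∈ , z≢a , z≢b))

rotateΠ : Fin 6 → Fin 6
rotateΠ 0F = 1F
rotateΠ 1F = 2F
rotateΠ 2F = 0F
rotateΠ 3F = 4F
rotateΠ 4F = 5F
rotateΠ 5F = 3F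

rotateΠ³≡id : ∀ i → rotateΠ (rotateΠ (rotateΠ i)) ≡ i
rotateΠ³≡id 0F = refl
rotateΠ³≡id 1F = refl
rotateΠ³≡id 2F = refl
rotateΠ³≡id 3F = refl
rotateΠ³≡id 4F = refl
rotateΠ³≡id 5F = refl

rotateΠ-injective : Injective _≡_ _≡_ rotateΠ
rotateΠ-injective {i} {j} rᵢ≡rⱼ =
  trans (sym (rotateΠ³≡id i)) (trans (cong (rotateΠ ∘ rotateΠ) rᵢ≡rⱼ) (rotateΠ³≡id j))

rotateΠ-edge : ∀ {i j} → ΠEdge i j → ΠEdge (rotateΠ i) (rotateΠ j)
rotateΠ-edge e01 = e12
rotateΠ-edge e12 = e20
rotateΠ-edge e20 = e01
rotateΠ-edge e03 = e14
rotateΠ-edge e14 = e25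
rotateΠ-edge e25 = e03

rotate : ∀ {n} (Γ : Graph n) → ContainsΠ Γ → ContainsΠ Γ
rotate _ (f , f-injective , f-edge) =
  f ∘ rotateΠ , (λ fᵢ≡fⱼ → rotateΠ-injective (f-injective fᵢ≡fⱼ)) , λ _ _ ij → f-edge _ _ (rotateΠ-edge ij)

Π-copy : ∀ {n} {Γ : Graph n} {a b c a′ b′ c′} → Unique (a ∷ b ∷ c ∷ a′ ∷ b′ ∷ c′ ∷ []) →
         Adj Γ a b → Adj Γ b c → Adj Γ c a → Adj Γ a a′ → Adj Γ b b′ → Adj Γ c c′ → ContainsΠ Γ
Π-copy {n} {Γ} {a} {b} {c} {a′} {b′} {c′} distinct ab bc ca aa′ bb′ cc′ =
  lookup vs , Unique⇒lookup-injective vs distinct , edge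
  where
  vs : List (Fin n)
  vs = a ∷ b ∷ c ∷ a′ ∷ b′ ∷ c′ ∷ []
  edge : ∀ i j → ΠEdge i j → Adj Γ (lookup vs i) (lookup vs j)
  edge _ _ e01 = ab
  edge _ _ e12 = bc
  edge _ _ e20 = ca
  edge _ _ e03 = aa′
  edge _ _ e14 = bb′
  edge _ _ e25 = cc′

module CopyOfΠ {n} (Γ : Graph n) (copy : ContainsΠ Γ) where

  vertex : Fin 6 → Fin n
  vertex = proj₁ copy

  a b c a′ : Fin n
  a  = vertex 0F
  b  = vertex 1F
  c  = vertex 2F
  a′ = vertex 3F

  distinct : ∀ {i j} → i ≢ j → vertex i ≢ vertex j
  distinct i≢j = i≢j ∘ proj₁ (proj₂ copy)

  edge : ∀ {i j} → ΠEdge i j → Adj Γ (vertex i) (vertex j)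
  edge = proj₂ (proj₂ copy) _ _

module Necessity {n} (Γ : Graph n) (cubic : Cubic Γ) (H : PartialOrientation Γ) (qt : QuasiTransitive H) where
  open GraphFacts Γ
  open CubicFacts Γ cubic

  arc? : ∀ x y → Dec (Arc H x y)
  arc? x y = arc H x y ≟ᵇ true

  arc-adj : ∀ {x y} → Arc H x y → Adj Γ x y
  arc-adj = arc⇒adj H _ _

  dipath-closes : ∀ {x y z} → Arc H x y → Arc H y z → Adj Γ x z
  dipath-closes {x} {y} {z} x→y y→z with adj? x z
  ... | yes xz  = xz
  ... | no ¬xz = ⊥-elim (proj₁ qt x y z ((x→y , y→z) , ¬xz))

  Witness : Fin n → Fin n → Fin n → Set
  Witness x t y = TwoDipath H x t y ⊎ TwoDipath H y t x

  witness-is-common-neighbour : ∀ {x t y} → Witness x t y → Adj Γ x t × Adj Γ y t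
  witness-is-common-neighbour (inj₁ (x→t , t→y)) = arc-adj x→t , adj-sym (arc-adj t→y)
  witness-is-common-neighbour (inj₂ (y→t , t→x)) = adj-sym (arc-adj t→x) , arc-adj y→t

  oriented-unless-witnessed : ∀ {x y} → Adj Γ x y → (∀ t → ¬ Witness x t y) → Arc H x y ⊎ Arc H y x
  oriented-unless-witnessed {x} {y} xy unwitnessed with arc? x y | arc? y x
  ... | yes x→y | _       = inj₁ x→y
  ... | no _    | yes y→x = inj₂ y→x
  ... | no ¬x→y | no ¬y→x = let t , w = proj₂ qt x y (xy , ¬x→y , ¬y→x) in ⊥-elim (unwitnessed t w)

  nonTri-oriented : ∀ {x y} → NonTriAdj Γ x y → Arc H x y ⊎ Arc H y x
  nonTri-oriented (xy , ¬tri) = oriented-unless-witnessed xy λ t w → ¬tri (t , witness-is-common-neighbour w)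

  emits? : ∀ x → Dec (∃ λ w → NonTriAdj Γ x w × Arc H x w)
  emits? x = any? λ w → NonTriAdj? x w ×-dec arc? x w

  emits : Fin n → Bool
  emits x = does (emits? x)

  -- A further non-triangle arc y → w would force the chord xw, putting xy in a triangle.
  nonTri-arc-emits : ∀ {x y} → NonTriAdj Γ x y → Arc H x y → emits x ≡ true × emits y ≡ false
  nonTri-arc-emits {x} {y} xy x→y =
    dec-true (emits? x) (y , xy , x→y) ,
    dec-false (emits? y) λ (w , yw , y→w) → proj₂ xy (w , dipath-closes x→y y→w , arc-adj y→w)

  emits-proper : ProperColouring (NonTriAdj Γ) emits
  emits-proper xy with nonTri-oriented xy
  ... | inj₁ x→y = let ex , ey = nonTri-arc-emits xy x→y in λ e → true≢false (trans (sym ex) (trans e ey))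
  ... | inj₂ y→x = let ey , ex = nonTri-arc-emits (NonTriAdj-sym xy) y→x in
                   λ e → true≢false (trans (sym ey) (trans (sym e) ex))

  ¬HasOddCycle : ¬ HasOddCycle (NonTriAdj Γ)
  ¬HasOddCycle = ProperColouring⇒¬HasOddCycle emits-proper

  Source Sink Status : Fin n → Set
  Source v = ∀ x → ¬ Arc H x v
  Sink   v = ∀ x → ¬ Arc H v x
  Status v = Source v ⊎ Sink v

  pendant-status : ∀ {v p q w} → Adj Γ v p → Adj Γ v q → Adj Γ v w → p ≢ q → p ≢ w → q ≢ w →
                   ¬ Adj Γ w p → ¬ Adj Γ w q → Status v
  pendant-status {v} {p} {q} {w} vp vq vw p≢q p≢w q≢w ¬wp ¬wq =
    status (oriented-unless-witnessed vw unwitnessed)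
    where
    far-from-w : ∀ {x} → Adj Γ v x → ¬ Adj Γ w x
    far-from-w vx wx with neighbour-is-one-of vp vq vw p≢q p≢w q≢w vx
    ... | inj₁ refl        = ¬wp wx
    ... | inj₂ (inj₁ refl) = ¬wq wx
    ... | inj₂ (inj₂ refl) = adj-irrefl wx
    unwitnessed : ∀ t → ¬ Witness v t w
    unwitnessed t wit = let vt , wt = witness-is-common-neighbour wit in far-from-w vt wt
    status : Arc H v w ⊎ Arc H w v → Status v
    status (inj₁ v→w) = inj₁ λ x x→v → far-from-w (adj-sym (arc-adj x→v)) (adj-sym (dipath-closes x→v v→w))
    status (inj₂ w→v) = inj₂ λ x v→x → far-from-w (arc-adj v→x) (dipath-closes w→v v→x)

  ¬midpoint : ∀ {x t y} → Status t → ¬ Witness x t y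
  ¬midpoint (inj₁ source) (inj₁ (x→t , _)) = source _ x→t
  ¬midpoint (inj₁ source) (inj₂ (y→t , _)) = source _ y→t
  ¬midpoint (inj₂ sink)   (inj₁ (_ , t→y)) = sink _ t→y
  ¬midpoint (inj₂ sink)   (inj₂ (_ , t→x)) = sink _ t→x

  oriented-via-apex : ∀ {x y z} → Adj Γ x y → (∀ {t} → Adj Γ x t → Adj Γ y t → t ≡ z) → Status z →
                      Arc H x y ⊎ Arc H y x
  oriented-via-apex xy apex z-status = oriented-unless-witnessed xy λ t wit →
    let xt , yt = witness-is-common-neighbour wit in ¬midpoint (subst Status (sym (apex xt yt)) z-status) wit

  same-status-unoriented : ∀ {x y} → (Source x × Source y) ⊎ (Sink x × Sink y) → ¬ (Arc H x y ⊎ Arc H y x)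
  same-status-unoriented (inj₁ (_ , y-source)) (inj₁ x→y) = y-source _ x→y
  same-status-unoriented (inj₁ (x-source , _)) (inj₂ y→x) = x-source _ y→x
  same-status-unoriented (inj₂ (x-sink , _))   (inj₁ x→y) = x-sink _ x→y
  same-status-unoriented (inj₂ (_ , y-sink))   (inj₂ y→x) = y-sink _ y→x

  module _ (copy : ContainsΠ Γ) where
    open CopyOfΠ Γ copy

    b≁a′ : ¬ Adj Γ b a′
    b≁a′ ba′ with neighbour-is-one-of (adj-sym (edge e01)) (edge e12) (edge e14)
                    (distinct λ ()) (distinct λ ()) (distinct λ ()) ba′
    ... | inj₁ a′≡a        = distinct (λ ()) a′≡a
    ... | inj₂ (inj₁ a′≡c) = distinct (λ ()) a′≡c
    ... | inj₂ (inj₂ a′≡b′) = distinct (λ ()) a′≡b′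

    c≁a′ : ¬ Adj Γ c a′
    c≁a′ ca′ with neighbour-is-one-of (edge e20) (adj-sym (edge e12)) (edge e25)
                    (distinct λ ()) (distinct λ ()) (distinct λ ()) ca′
    ... | inj₁ a′≡a        = distinct (λ ()) a′≡a
    ... | inj₂ (inj₁ a′≡b) = distinct (λ ()) a′≡b
    ... | inj₂ (inj₂ a′≡c′) = distinct (λ ()) a′≡c′

    corner-status : Status a
    corner-status = pendant-status (edge e01) (adj-sym (edge e20)) (edge e03)
                      (distinct λ ()) (distinct λ ()) (distinct λ ()) (b≁a′ ∘ adj-sym) (c≁a′ ∘ adj-sym)

    apex-ab : ∀ {t} → Adj Γ a t → Adj Γ b t → t ≡ c
    apex-ab at bt with neighbour-is-one-of (edge e01) (adj-sym (edge e20)) (edge e03)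
                         (distinct λ ()) (distinct λ ()) (distinct λ ()) at
    ... | inj₁ refl        = ⊥-elim (adj-irrefl bt)
    ... | inj₂ (inj₁ t≡c) = t≡c
    ... | inj₂ (inj₂ refl) = ⊥-elim (b≁a′ bt)

  triangle-edge-oriented : (copy : ContainsΠ Γ) → let open CopyOfΠ Γ copy in Arc H a b ⊎ Arc H b a
  triangle-edge-oriented copy =
    oriented-via-apex (CopyOfΠ.edge Γ copy e01) (apex-ab copy) (corner-status (rotate Γ (rotate Γ copy)))

  ¬ContainsΠ : ¬ ContainsΠ Γ
  ¬ContainsΠ copy
    with corner-status copy | corner-status (rotate Γ copy) | corner-status (rotate Γ (rotate Γ copy))
  ... | inj₁ a-src | inj₁ b-src | _          = same-status-unoriented (inj₁ (a-src , b-src))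
    (triangle-edge-oriented copy)
  ... | inj₂ a-snk | inj₂ b-snk | _          = same-status-unoriented (inj₂ (a-snk , b-snk))
    (triangle-edge-oriented copy)
  ... | inj₁ _     | inj₂ b-snk | inj₂ c-snk = same-status-unoriented (inj₂ (b-snk , c-snk))
    (triangle-edge-oriented (rotate Γ copy))
  ... | inj₂ _     | inj₁ b-src | inj₁ c-src = same-status-unoriented (inj₁ (b-src , c-src))
    (triangle-edge-oriented (rotate Γ copy))
  ... | inj₁ a-src | inj₂ _     | inj₁ c-src = same-status-unoriented (inj₁ (c-src , a-src))
    (triangle-edge-oriented (rotate Γ (rotate Γ copy)))
  ... | inj₂ a-snk | inj₁ _     | inj₂ c-snk = same-status-unoriented (inj₂ (c-snk , a-snk))
    (triangle-edge-oriented (rotate Γ (rotate Γ copy)))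

module Sufficiency {n} (Γ : Graph n) (cubic : Cubic Γ) (Π-free : ¬ ContainsΠ Γ)
                   (no-odd-cycle : ¬ HasOddCycle (NonTriAdj Γ)) where
  open GraphFacts Γ
  open CubicFacts Γ cubic

  OnNonTriEdge : Fin n → Set
  OnNonTriEdge x = ∃ (NonTriAdj Γ x)

  OnNonTriEdge? : ∀ x → Dec (OnNonTriEdge x)
  OnNonTriEdge? x = any? (NonTriAdj? x)

  InTwoTriangles : Fin n → Fin n → Set
  InTwoTriangles x y = Adj Γ x y × ∃ λ z → ∃ λ w → z ≢ w × (Adj Γ x z × Adj Γ y z) × (Adj Γ x w × Adj Γ y w)

  InTwoTriangles? : ∀ x y → Dec (InTwoTriangles x y)
  InTwoTriangles? x y = adj? x y ×-dec any? λ z → any? λ w →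
    ¬? (z ≟ w) ×-dec (adj? x z ×-dec adj? y z) ×-dec (adj? x w ×-dec adj? y w)

  InTwoTriangles-sym : ∀ {x y} → InTwoTriangles x y → InTwoTriangles y x
  InTwoTriangles-sym (xy , z , w , z≢w , (xz , yz) , (xw , yw)) = adj-sym xy , z , w , z≢w , (yz , xz) , (yw , xw)

  Π-from-triangle : ∀ {x y z x′ y′} → Adj Γ x y → Adj Γ y z → Adj Γ z x → NonTriAdj Γ x x′ → NonTriAdj Γ y y′ →
                    ContainsΠ Γ
  Π-from-triangle {x} {y} {z} {x′} {y′} xy yz zx (xx′ , x-free) (yy′ , y-free) =
    let z′ , zz′ , z′≢x , z′≢y = third-neighbour zx (adj-sym yz) in
    Π-copy {Γ = Γ}
      ( (adj⇒≢ xy ∷ adj⇒≢ (adj-sym zx) ∷ adj⇒≢ xx′ ∷ x≢y′ ∷ ≢-sym z′≢x ∷ [])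
      ∷ (adj⇒≢ yz ∷ y≢x′ ∷ adj⇒≢ yy′ ∷ ≢-sym z′≢y ∷ [])
      ∷ (z≢x′ ∷ z≢y′ ∷ adj⇒≢ zz′ ∷ [])
      ∷ (x′≢y′ ∷ (λ { refl → x-free (z , adj-sym zx , adj-sym zz′) }) ∷ [])
      ∷ ((λ { refl → y-free (z , yz , adj-sym zz′) }) ∷ [])
      ∷ [] ∷ [])
      xy yz zx xx′ yy′ zz′
    where
    x≢y′ : x ≢ y′
    x≢y′ refl = y-free (z , yz , adj-sym zx)
    y≢x′ : y ≢ x′
    y≢x′ refl = x-free (z , adj-sym zx , yz)
    z≢x′ : z ≢ x′
    z≢x′ refl = x-free (y , xy , adj-sym yz)
    z≢y′ : z ≢ y′
    z≢y′ refl = y-free (x , adj-sym xy , zx)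
    x′≢y′ : x′ ≢ y′
    x′≢y′ refl = x-free (y , xy , adj-sym yy′)

  nonTri-vertex-¬InTwoTriangles : ∀ {x y} → OnNonTriEdge x → ¬ InTwoTriangles x y
  nonTri-vertex-¬InTwoTriangles (x′ , xx′ , x-free) (xy , p , q , p≢q , (xp , yp) , (xq , yq)) =
    case neighbour-is-one-of xx′ xy xp x′≢y x′≢p (adj⇒≢ yp) xq of λ where
      (inj₁ refl)        → x-free (_ , xy , adj-sym yq)
      (inj₂ (inj₁ refl)) → adj-irrefl yq
      (inj₂ (inj₂ q≡p))  → p≢q (sym q≡p)
    where
    x′≢y : x′ ≢ _
    x′≢y refl = x-free (p , xp , yp)
    x′≢p : x′ ≢ p
    x′≢p refl = x-free (_ , xy , adj-sym yp)

  triangle-has-one-nonTri-vertex : ∀ {x y} → OnNonTriEdge x → Adj Γ x y → InTriangle Γ x y → ¬ OnNonTriEdge y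
  triangle-has-one-nonTri-vertex (_ , x-free) xy (z , xz , yz) (_ , y-free) =
    Π-free (Π-from-triangle xy yz (adj-sym xz) x-free y-free)

  third-neighbour-adjacent-to-apex : ∀ {x y z} → Adj Γ x y → Adj Γ x z → Adj Γ y z →
    ¬ InTwoTriangles x y → ¬ OnNonTriEdge x → ∃ λ x′ → Adj Γ x x′ × x′ ≢ y × x′ ≢ z × Adj Γ z x′
  third-neighbour-adjacent-to-apex {x} {y} {z} xy xz yz ¬two x-closed
    with third-neighbour xy xz
  ... | x′ , xx′ , x′≢y , x′≢z with ¬NonTriAdj⇒InTriangle xx′ (λ nt → x-closed (x′ , nt))
  ...   | t , xt , x′t with neighbour-is-one-of xy xz xx′ (adj⇒≢ yz) (≢-sym x′≢y) (≢-sym x′≢z) xt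
  ...     | inj₁ refl        = ⊥-elim (¬two (xy , z , x′ , ≢-sym x′≢z , (xz , yz) , (xx′ , adj-sym x′t)))
  ...     | inj₂ (inj₁ refl) = x′ , xx′ , x′≢y , x′≢z , adj-sym x′t
  ...     | inj₂ (inj₂ refl) = ⊥-elim (adj-irrefl x′t)

  -- In a triangle xyz with xy in no other triangle, the third neighbours of x and y would both be
  -- adjacent to z, hence equal, giving xy a second triangle.
  single-triangle-edge-meets-nonTri : ∀ {x y} → Adj Γ x y → InTriangle Γ x y → ¬ InTwoTriangles x y →
                                      OnNonTriEdge x ⊎ OnNonTriEdge y
  single-triangle-edge-meets-nonTri {x} {y} xy (z , xz , yz) ¬two with OnNonTriEdge? x | OnNonTriEdge? y
  ... | yes x-open | _          = inj₁ x-open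
  ... | no _       | yes y-open = inj₂ y-open
  ... | no x-closed | no y-closed
    with third-neighbour-adjacent-to-apex xy xz yz ¬two x-closed
       | third-neighbour-adjacent-to-apex (adj-sym xy) yz xz (¬two ∘ InTwoTriangles-sym) y-closed
  ... | x′ , xx′ , x′≢y , x′≢z , zx′ | y′ , yy′ , y′≢x , _ , zy′
    with neighbour-is-one-of (adj-sym xz) (adj-sym yz) zx′ (adj⇒≢ xy) (adj⇒≢ xx′) (≢-sym x′≢y) zy′
  ...   | inj₁ y′≡x        = ⊥-elim (y′≢x y′≡x)
  ...   | inj₂ (inj₁ refl) = ⊥-elim (adj-irrefl yy′)
  ...   | inj₂ (inj₂ refl) = ⊥-elim (¬two (xy , z , y′ , ≢-sym x′≢z , (xz , yz) , (xx′ , yy′)))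

  InTwoTriangles-closes : ∀ {x y z} → InTwoTriangles x y → Adj Γ y z → z ≢ x → Adj Γ x z
  InTwoTriangles-closes (xy , p , q , p≢q , (xp , yp) , (xq , yq)) yz z≢x
    with neighbour-is-one-of (adj-sym xy) yp yq (adj⇒≢ xp) (adj⇒≢ xq) p≢q yz
  ... | inj₁ z≡x         = ⊥-elim (z≢x z≡x)
  ... | inj₂ (inj₁ refl) = xp
  ... | inj₂ (inj₂ refl) = xq

  opposite-edge-in-two-triangles : ∀ {x y z} → OnNonTriEdge x → Adj Γ x y → Adj Γ x z → Adj Γ y z →
                                   InTwoTriangles y z
  opposite-edge-in-two-triangles x-open xy xz yz
    with third-neighbour-adjacent-to-apex (adj-sym xy) yz xz
           (nonTri-vertex-¬InTwoTriangles x-open ∘ InTwoTriangles-sym)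
           (triangle-has-one-nonTri-vertex x-open xy (_ , xz , yz))
  ... | w , yw , w≢x , _ , zw = yz , _ , w , ≢-sym w≢x , (adj-sym xy , adj-sym xz) , (yw , zw)

  colouring : ∃ (ProperColouring (NonTriAdj Γ))
  colouring = TwoColouring.proper-colouring (NonTriAdj Γ) NonTriAdj? NonTriAdj-sym NonTriAdj-irrefl no-odd-cycle

  colour : Fin n → Bool
  colour = proj₁ colouring

  colour-proper : ProperColouring (NonTriAdj Γ) colour
  colour-proper = proj₂ colouring

  colour-across : ∀ {x y} → NonTriAdj Γ x y → colour y ≡ not (colour x)
  colour-across xy = ¬-not (≢-sym (colour-proper xy))

  Apex : (Fin n → Set) → Fin n → Fin n → Set
  Apex P x y = ∃ λ z → Adj Γ x z × Adj Γ y z × P z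

  Apex? : ∀ {P} → (∀ z → Dec (P z)) → ∀ x y → Dec (Apex P x y)
  Apex? P? x y = any? λ z → adj? x z ×-dec adj? y z ×-dec P? z

  -- In a Π-free cubic graph every triangle lies in a K₄ or in a diamond, whose two tips are the vertices
  -- on non-triangle edges. Non-triangle edges leave colour true; edges in two triangles follow the order
  -- of Fin n; a tip t of a diamond with centres u < v sends an arc to u if t has colour true, receives one
  -- from v if it has colour false, and its other edge stays unoriented, witnessed through uv.
  data Arrow (x y : Fin n) : Set where
    nonTri   : NonTriAdj Γ x y → colour x ≡ true → Arrow x y
    twoTri   : InTwoTriangles x y → x < y → Arrow x y
    from-tip : Adj Γ x y → OnNonTriEdge x → colour x ≡ true → Apex (y <_) x y → Arrow x y
    to-tip   : Adj Γ x y → OnNonTriEdge y → colour y ≡ false → Apex (_< x) x y → Arrow x y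

  arrow? : ∀ x y → Dec (Arrow x y)
  arrow? x y
    with NonTriAdj? x y ×-dec colour x ≟ᵇ true
       | InTwoTriangles? x y ×-dec x <? y
       | adj? x y ×-dec OnNonTriEdge? x ×-dec colour x ≟ᵇ true ×-dec Apex? (y <?_) x y
       | adj? x y ×-dec OnNonTriEdge? y ×-dec colour y ≟ᵇ false ×-dec Apex? (_<? x) x y
  ... | yes (xy , c) | _ | _ | _                         = yes (nonTri xy c)
  ... | no _ | yes (xy , lt) | _ | _                     = yes (twoTri xy lt)
  ... | no _ | no _ | yes (xy , open′ , c , apex) | _     = yes (from-tip xy open′ c apex)
  ... | no _ | no _ | no _ | yes (xy , open′ , c , apex) = yes (to-tip xy open′ c apex)
  ... | no ¬nonTri | no ¬twoTri | no ¬from-tip | no ¬to-tip = no λ where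
    (nonTri xy c)                → ¬nonTri (xy , c)
    (twoTri xy lt)               → ¬twoTri (xy , lt)
    (from-tip xy open′ c apex)   → ¬from-tip (xy , open′ , c , apex)
    (to-tip xy open′ c apex)     → ¬to-tip (xy , open′ , c , apex)

  arrow⇒adj : ∀ {x y} → Arrow x y → Adj Γ x y
  arrow⇒adj (nonTri xy _)       = proj₁ xy
  arrow⇒adj (twoTri xy _)       = proj₁ xy
  arrow⇒adj (from-tip xy _ _ _) = xy
  arrow⇒adj (to-tip xy _ _ _)   = xy

  arrow-out-of-nonTri-vertex : ∀ {x y} → OnNonTriEdge x → Arrow x y → colour x ≡ true
  arrow-out-of-nonTri-vertex _      (nonTri _ cx)              = cx
  arrow-out-of-nonTri-vertex x-open (twoTri xy _)              = ⊥-elim (nonTri-vertex-¬InTwoTriangles x-open xy)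
  arrow-out-of-nonTri-vertex _      (from-tip _ _ cx _)        = cx
  arrow-out-of-nonTri-vertex x-open (to-tip xy y-open _ (z , xz , yz , _)) =
    ⊥-elim (triangle-has-one-nonTri-vertex y-open (adj-sym xy) (z , yz , xz) x-open)

  arrow-into-nonTri-vertex : ∀ {x y} → OnNonTriEdge y → Arrow x y → colour y ≡ false
  arrow-into-nonTri-vertex _      (nonTri xy cx)     = trans (colour-across xy) (cong not cx)
  arrow-into-nonTri-vertex y-open (twoTri xy _)      =
    ⊥-elim (nonTri-vertex-¬InTwoTriangles y-open (InTwoTriangles-sym xy))
  arrow-into-nonTri-vertex y-open (from-tip xy x-open _ (z , xz , yz , _)) =
    ⊥-elim (triangle-has-one-nonTri-vertex x-open xy (z , xz , yz) y-open)
  arrow-into-nonTri-vertex _      (to-tip _ _ cy _)  = cy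

  arrow-between-closed-vertices : ∀ {x y} → ¬ OnNonTriEdge x → ¬ OnNonTriEdge y → Arrow x y → x < y
  arrow-between-closed-vertices x-closed _ (nonTri xy _)           = ⊥-elim (x-closed (_ , xy))
  arrow-between-closed-vertices _        _ (twoTri _ x<y)          = x<y
  arrow-between-closed-vertices x-closed _ (from-tip _ x-open _ _) = ⊥-elim (x-closed x-open)
  arrow-between-closed-vertices _ y-closed (to-tip _ y-open _ _)   = ⊥-elim (y-closed y-open)

  arrow-asym : ∀ {x y} → Arrow x y → ¬ Arrow y x
  arrow-asym {x} {y} x→y y→x with OnNonTriEdge? x | OnNonTriEdge? y
  ... | yes x-open | _ =
    true≢false (trans (sym (arrow-out-of-nonTri-vertex x-open x→y)) (arrow-into-nonTri-vertex x-open y→x))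
  ... | no _ | yes y-open =
    true≢false (trans (sym (arrow-out-of-nonTri-vertex y-open y→x)) (arrow-into-nonTri-vertex y-open x→y))
  ... | no x-closed | no y-closed =
    <-asym (arrow-between-closed-vertices x-closed y-closed x→y) (arrow-between-closed-vertices y-closed x-closed y→x)

  -- If xz is no edge, w′ must be y's third neighbour w; but w lies above y and w′ below it.
  apexes-across-force-chord : ∀ {x y z} → Adj Γ x y → Adj Γ y z → x ≢ z →
                              Apex (y <_) x y → Apex (_< y) y z → Adj Γ x z
  apexes-across-force-chord {x} {y} {z} xy yz x≢z (w , xw , yw , y<w) (w′ , yw′ , zw′ , w′<y) with adj? x z
  ... | yes xz  = xz
  ... | no ¬xz with neighbour-is-one-of (adj-sym xy) yz yw x≢z (adj⇒≢ xw) (λ { refl → ¬xz xw }) yw′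
  ...   | inj₁ refl        = ⊥-elim (¬xz (adj-sym zw′))
  ...   | inj₂ (inj₁ refl) = ⊥-elim (adj-irrefl zw′)
  ...   | inj₂ (inj₂ refl) = ⊥-elim (<-asym y<w w′<y)

  arrow-path-through-closed-vertex : ∀ {x y z} → ¬ OnNonTriEdge y → Arrow x y → Arrow y z → Adj Γ x z
  arrow-path-through-closed-vertex _ x→y@(twoTri xy _) y→z =
    InTwoTriangles-closes xy (arrow⇒adj y→z) λ { refl → arrow-asym x→y y→z }
  arrow-path-through-closed-vertex _ x→y y→z@(twoTri yz _) =
    adj-sym (InTwoTriangles-closes (InTwoTriangles-sym yz) (adj-sym (arrow⇒adj x→y)) λ { refl → arrow-asym x→y y→z })
  arrow-path-through-closed-vertex y-closed (nonTri xy _)        _ = ⊥-elim (y-closed (_ , NonTriAdj-sym xy))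
  arrow-path-through-closed-vertex y-closed (to-tip _ y-open _ _) _ = ⊥-elim (y-closed y-open)
  arrow-path-through-closed-vertex y-closed _ (nonTri yz _)          = ⊥-elim (y-closed (_ , yz))
  arrow-path-through-closed-vertex y-closed _ (from-tip _ y-open _ _) = ⊥-elim (y-closed y-open)
  arrow-path-through-closed-vertex _ x→y@(from-tip xy _ _ apex₁) y→z@(to-tip yz _ _ apex₂) =
    apexes-across-force-chord xy yz (λ { refl → arrow-asym x→y y→z }) apex₁ apex₂

  arrow-path-closes : ∀ {x y z} → Arrow x y → Arrow y z → Adj Γ x z
  arrow-path-closes {y = y} x→y y→z with OnNonTriEdge? y
  ... | yes y-open   =
    ⊥-elim (true≢false (trans (sym (arrow-out-of-nonTri-vertex y-open y→z)) (arrow-into-nonTri-vertex y-open x→y)))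
  ... | no y-closed = arrow-path-through-closed-vertex y-closed x→y y→z

  Witnessed : Fin n → Fin n → Set
  Witnessed x y = ∃ λ t → (Arrow x t × Arrow t y) ⊎ (Arrow y t × Arrow t x)

  nonTri-edge-oriented : ∀ {x y} → NonTriAdj Γ x y → Arrow x y ⊎ Arrow y x
  nonTri-edge-oriented {x} xy with colour x in cx
  ... | true  = inj₁ (nonTri xy cx)
  ... | false = inj₂ (nonTri (NonTriAdj-sym xy) (trans (colour-across xy) (cong not cx)))

  twoTri-edge-oriented : ∀ {x y} → InTwoTriangles x y → Arrow x y ⊎ Arrow y x
  twoTri-edge-oriented {x} {y} xy with <-cmp x y
  ... | tri< x<y _ _ = inj₁ (twoTri xy x<y)
  ... | tri≈ _ refl _ = ⊥-elim (adj-irrefl (proj₁ xy))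
  ... | tri> _ _ y<x = inj₂ (twoTri (InTwoTriangles-sym xy) y<x)

  tip-edge-witnessed : ∀ {x y} → OnNonTriEdge x → Adj Γ x y → InTriangle Γ x y →
                       ¬ Arrow x y → ¬ Arrow y x → Witnessed x y
  tip-edge-witnessed {x} {y} x-open xy (z , xz , yz) ¬x→y ¬y→x with colour x in cx | <-cmp y z
  ... | _     | tri≈ _ refl _ = ⊥-elim (adj-irrefl yz)
  ... | true  | tri< y<z _ _ = ⊥-elim (¬x→y (from-tip xy x-open cx (z , xz , yz , y<z)))
  ... | true  | tri> _ _ z<y =
    z , inj₁ ( from-tip xz x-open cx (y , xy , adj-sym yz , z<y)
             , twoTri (InTwoTriangles-sym (opposite-edge-in-two-triangles x-open xy xz yz)) z<y)
  ... | false | tri> _ _ z<y = ⊥-elim (¬y→x (to-tip (adj-sym xy) x-open cx (z , yz , xz , z<y)))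
  ... | false | tri< y<z _ _ =
    z , inj₂ ( twoTri (opposite-edge-in-two-triangles x-open xy xz yz) y<z
             , to-tip (adj-sym xz) x-open cx (y , adj-sym yz , xy , y<z))

  unoriented-edge-witnessed : ∀ {x y} → Adj Γ x y → ¬ Arrow x y → ¬ Arrow y x → Witnessed x y
  unoriented-edge-witnessed {x} {y} xy ¬x→y ¬y→x with NonTriAdj? x y | InTwoTriangles? x y
  ... | yes nt | _      = ⊥-elim ([ ¬x→y , ¬y→x ]′ (nonTri-edge-oriented nt))
  ... | no _   | yes two = ⊥-elim ([ ¬x→y , ¬y→x ]′ (twoTri-edge-oriented two))
  ... | no ¬nt | no ¬two with single-triangle-edge-meets-nonTri xy (¬NonTriAdj⇒InTriangle xy ¬nt) ¬two
  ...   | inj₁ x-open = tip-edge-witnessed x-open xy (¬NonTriAdj⇒InTriangle xy ¬nt) ¬x→y ¬y→x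
  ...   | inj₂ y-open =
    let t , path = tip-edge-witnessed y-open (adj-sym xy) (InTriangle-sym (¬NonTriAdj⇒InTriangle xy ¬nt)) ¬y→x ¬x→y
    in t , swap path

  arc⇒arrow : ∀ {x y} → does (arrow? x y) ≡ true → Arrow x y
  arc⇒arrow {x} {y} with arrow? x y
  ... | yes x→y = λ _ → x→y
  ... | no _    = λ ()

  orientation : PartialOrientation Γ
  orientation = record
    { arc     = λ x y → does (arrow? x y)
    ; arc⇒adj = λ x y → arrow⇒adj ∘ arc⇒arrow
    ; antisym = λ x y x→y → dec-false (arrow? y x) (arrow-asym (arc⇒arrow x→y))
    }

  arrow⇒arc : ∀ {x y} → Arrow x y → Arc orientation x y
  arrow⇒arc {x} {y} = dec-true (arrow? x y)

  quasi-transitive : QuasiTransitive orientation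
  quasi-transitive = no-induced , witnessed
    where
    no-induced : ∀ x y z → ¬ InducedTwoDipath orientation x y z
    no-induced _ _ _ ((x→y , y→z) , ¬xz) = ¬xz (arrow-path-closes (arc⇒arrow x→y) (arc⇒arrow y→z))
    witnessed : ∀ x y → Edge orientation x y → ∃ λ t → TwoDipath orientation x t y ⊎ TwoDipath orientation y t x
    witnessed x y (xy , ¬x→y , ¬y→x) with unoriented-edge-witnessed xy (¬x→y ∘ arrow⇒arc) (¬y→x ∘ arrow⇒arc)
    ... | t , inj₁ (x→t , t→y) = t , inj₁ (arrow⇒arc x→t , arrow⇒arc t→y)
    ... | t , inj₂ (y→t , t→x) = t , inj₂ (arrow⇒arc y→t , arrow⇒arc t→x)

corollary3p7 : ∀ {n : ℕ} (Γ : Graph n) → Cubic Γ →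
    (Σ (PartialOrientation Γ) QuasiTransitive)
      ⇔ (¬ ContainsΠ Γ × ¬ HasOddCycle (NonTriAdj Γ))
corollary3p7 Γ cubic = mk⇔
  (λ (H , qt) → Necessity.¬ContainsΠ Γ cubic H qt , Necessity.¬HasOddCycle Γ cubic H qt)
  (λ (Π-free , bipartite) → Sufficiency.orientation Γ cubic Π-free bipartite
                          , Sufficiency.quasi-transitive Γ cubic Π-free bipartite)
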